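{- Let $P$ be a $d$-dimensional convex polytope and let $O$ be an acyclic orientation of its graph $G_P=(V_P,E_P)$. Then $$f^O \;\geq\; \sum_{v\in V_P} \bigl|\{\text{faces } F \text{ of } P : v \text{ is a sink of } G_F \text{ with respect to } O\}\bigr| \;\geq\; \sum_{i=0}^d f_i(P),$$ where $f_i(P)$ is the number of $i$-dimensional faces of $P$.
   Context: The graph $G_P$ of a polytope $P$ has vertex set $V_P$ the vertices of $P$ and edges the pairs of vertices forming a $1$-dimensional face of $P$; for a face $F$ of $P$, $G_F$ is the graph of $F$ (the subgraph of $G_P$ induced on the vertices of $F$), carrying the orientation induced by $O$. For an orientation $O$ of a graph $G=(V,E)$, $f^O:=\sum_{v\in V}2^{\operatorname{indeg}(v)}$, where $\operatorname{indeg}(v)$ is the number of edges oriented towards $v$. A sink of a graph with respect to an orientation is a vertex all of whose incident edges are oriented towards it. -}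

module Defs where

open import Level using (0ℓ)
open import Data.Nat using (ℕ; zero; suc; _^_) renaming (_≤_ to _≤ℕ_)
open import Data.Bool using (Bool; true; false; if_then_else_)
open import Data.Fin using (Fin)
open import Data.Fin.Subset using (Subset; _∈_)
open import Data.List using (List; map; allFin; length)
open import Data.Nat.ListAction using (sum)
open import Data.List.Relation.Unary.Unique.Propositional using (Unique)
import Data.List.Membership.Propositional as Mem
open import Data.Product using (Σ; ∃; _×_; _,_)
open import Data.Sum using (_⊎_)
open import Relation.Nullary using (¬_)
open import Relation.Binary.PropositionalEquality using (_≡_; _≢_)
open import Relation.Binary.Construct.Closure.Transitive using (TransClosure)
open import Algebra.Structures using (IsCommutativeRing)
open import Relation.Binary.Structures using (IsTotalOrder)
open import Function.Bundles using (_⇔_)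

-- Ordered fields (the stdlib has none).  The real numbers are an
-- instance; the theorem is stated over an arbitrary ordered field.

record OrderedField : Set₁ where
  infixl 6 _+_
  infixl 7 _*_
  infix 4 _≤_ _<_
  field
    Carrier : Set
    _+_ _*_ : Carrier → Carrier → Carrier
    -_      : Carrier → Carrier
    0# 1#   : Carrier
    isCommutativeRing : IsCommutativeRing _≡_ _+_ _*_ -_ 0# 1#
    _⁻¹     : Carrier → Carrier
    0≢1     : 0# ≢ 1#
    ⁻¹-inverse : ∀ x → x ≢ 0# → x * (x ⁻¹) ≡ 1#
    _≤_     : Carrier → Carrier → Set
    isTotalOrder : IsTotalOrder _≡_ _≤_
    +-mono-≤ : ∀ {x y} z → x ≤ y → x + z ≤ y + z
    *-nonneg : ∀ {x y} → 0# ≤ x → 0# ≤ y → 0# ≤ x * y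

  _<_ : Carrier → Carrier → Set
  x < y = (x ≤ y) × (x ≢ y)

module Polytope (𝔽 : OrderedField) where
  open OrderedField 𝔽

  Point : ℕ → Set
  Point d = Fin d → Carrier

  ΣF : ∀ {m} → (Fin m → Carrier) → Carrier
  ΣF {m} f = Data.List.foldr _+_ 0# (map f (allFin m))

  _·_ : ∀ {d} → Point d → Point d → Carrier
  c · x = ΣF (λ k → c k * x k)

  AffinelyIndependent : ∀ {d m} → (Fin m → Point d) → Set
  AffinelyIndependent {d} {m} q =
    (λ' : Fin m → Carrier) →
    ΣF λ' ≡ 0# →
    (∀ (k : Fin d) → ΣF (λ j → λ' j * q j k) ≡ 0#) →
    ∀ j → λ' j ≡ 0#

  -- A convex polytope P = conv{p 0, …, p (n-1)} ⊆ F^d, given by the list of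
  -- its vertices (each p i is a vertex: exposed by some linear functional),
  -- which is d-dimensional (contains d+1 affinely independent points).
  record IsDPolytope (d n : ℕ) (p : Fin n → Point d) : Set where
    field
      vertex : ∀ i → ∃ λ (c : Point d) → ∀ j → j ≢ i → c · p j < c · p i
      fullDim : ∃ λ (q : Fin (suc d) → Fin n) → AffinelyIndependent (λ j → p (q j))

  module _ {d n : ℕ} (p : Fin n → Point d) where

    -- Faces of P, identified with their vertex sets: intersections of P with
    -- a supporting halfspace c·x ≤ b (c = 0, b = 0 gives P; the empty face
    -- arises for b large).
    IsFace : Subset n → Set
    IsFace S = ∃ λ (c : Point d) → ∃ λ (b : Carrier) →
      (∀ i → c · p i ≤ b) × (∀ i → (i ∈ S) ⇔ (c · p i ≡ b))

    HasDim : Subset n → ℕ → Set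
    HasDim S k =
      (∃ λ (q : Fin (suc k) → Fin n) → (∀ j → q j ∈ S) × AffinelyIndependent (λ j → p (q j)))
      × (∀ (q : Fin (suc (suc k)) → Fin n) → (∀ j → q j ∈ S) → ¬ AffinelyIndependent (λ j → p (q j)))

    IsEdge : Fin n → Fin n → Set
    IsEdge u v = u ≢ v × ∃ λ S → IsFace S × HasDim S 1 × u ∈ S × v ∈ S ×
                 (∀ w → w ∈ S → (w ≡ u) ⊎ (w ≡ v))

    -- an orientation of G_P: o u v ≡ true means the edge {u,v} is oriented u → v
    record IsOrientation (o : Fin n → Fin n → Bool) : Set where
      field
        arc⇒edge : ∀ u v → o u v ≡ true → IsEdge u v
        edge⇒one : ∀ u v → IsEdge u v →
                   (o u v ≡ true × o v u ≡ false) ⊎ (o u v ≡ false × o v u ≡ true)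

    Acyclic : (Fin n → Fin n → Bool) → Set
    Acyclic o = ∀ v → ¬ TransClosure (λ x y → o x y ≡ true) v v

    indeg : (Fin n → Fin n → Bool) → Fin n → ℕ
    indeg o v = sum (map (λ u → if o u v then 1 else 0) (allFin n))

    fO : (Fin n → Fin n → Bool) → ℕ
    fO o = sum (map (λ v → 2 ^ indeg o v) (allFin n))

    IsSinkOf : (Fin n → Fin n → Bool) → Fin n → Subset n → Set
    IsSinkOf o v S = v ∈ S × (∀ u → u ∈ S → IsEdge u v → o u v ≡ true)

  -- "L is a duplicate-free enumeration of exactly the elements satisfying P":
  -- then length L is the cardinality of {x | P x}.
  Enumerates : {A : Set} → (A → Set) → List A → Set
  Enumerates {A} P L = Unique L × (∀ x → (x Mem.∈ L) ⇔ P x)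

-- A face F is determined by its sink v and the edges of F entering v: a face H through v whose
-- edges at v all lie in another face G through v is contained in G. So (v, F) ↦ (v, F ∩ N⁻(v)) is
-- injective, and there are Σ_v 2^indeg(v) = f^O possible images. Conversely, every nonempty face
-- has a sink since O is acyclic, and a face has only one dimension.
--
-- The containment H ⊆ G is proved by induction on the size of H. Suppose w ∈ H ∖ G and let ψ
-- expose v. Tilting ψ towards a functional χ with χ v < χ w until another vertex of H catches up
-- with v gives a face of H through v that leaves G; it is a smaller counterexample unless ψ + t χ
-- is constant on H. For χ = -c_G (c_G exposing G) constancy forces H ∩ G = {v}. If H = {v, w}, H is
-- an edge at v and w ∈ G after all. Otherwise H has a third vertex x, and constancy for the
-- functionals exposing w and for those exposing x orders ψ w and ψ x both ways. The order of the
-- field need not be decidable, so the argument runs in the double-negation monad, where the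
-- finitely many comparisons it makes can be decided.

module Submission where

open import Defs
open import Level using (Level; 0ℓ)
open import Algebra.Bundles using (CommutativeRing)
import Algebra.Properties.CommutativeSemigroup as CommutativeSemigroupProperties
import Algebra.Properties.Ring as RingProperties
open import Data.Bool using (Bool; true; false; if_then_else_)
import Data.Bool as Bool
open import Data.Bool.Properties using (¬-not)
open import Data.Empty using (⊥; ⊥-elim)
open import Data.Fin using (Fin; zero; suc; toℕ; _≟_)
open import Data.Fin.Properties using (any?; all?; ¬∀⟶∃¬; pigeonhole; <-irrefl)
open import Data.Fin.Subset using (Subset; inside; outside; _∈_; _∉_; _⊆_; _⊂_; _∩_; ∣_∣)
open import Data.Fin.Subset.Properties
  using (_∈?_; drop-∷-⊆; ⊆-antisym; p∩q⊆p; p∩q⊆q; x∈p∩q⁺; p⊂q⇒∣p∣<∣q∣)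
open import Data.List using (List; []; _∷_; _++_; map; foldr; concatMap; allFin; length)
import Data.List as List
open import Data.List.Properties using (length-++; length-map; map-tabulate; map-cong)
open import Data.List.Membership.Propositional using () renaming (_∈_ to _∈ₗ_)
open import Data.List.Membership.Propositional.Properties
  using (∈-map⁺; ∈-++⁺ˡ; ∈-++⁺ʳ; ∈-++⁻; ∈-∃++; ∈-concatMap⁺; ∈-allFin)
open import Data.List.Relation.Unary.Any using (here; there)
import Data.List.Relation.Unary.Any as Any
import Data.List.Relation.Unary.All as All
open import Data.List.Relation.Unary.AllPairs using (_∷_)
open import Data.List.Relation.Unary.Unique.Propositional using (Unique)
open import Data.Nat using (ℕ; zero; suc; s≤s; _≤′_; ≤′-reflexive; ≤′-step) renaming (_<_ to _<ℕ_)
import Data.Nat.Properties as ℕ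
open import Data.Nat.ListAction using (sum)
open import Data.Product using (∃; _×_; _,_; proj₁; proj₂)
open import Data.Sum using (_⊎_; inj₁; inj₂; [_,_]′)
open import Data.Vec using ([]; _∷_; here; lookup; tabulate)
open import Data.Vec.Properties using (lookup∘tabulate; []=⇒lookup; lookup⇒[]=)
open import Effect.Monad using (RawMonad)
open import Function using (_∘_; id; const)
open import Function.Bundles using (_⇔_; mk⇔; Equivalence)
open import Relation.Binary.Construct.Closure.Transitive using (TransClosure; [_]; _∷ʳ_)
open import Relation.Binary.Definitions using (tri<; tri≈; tri>)
open import Relation.Binary.PropositionalEquality
  using (_≡_; _≢_; refl; sym; trans; cong; cong₂; subst; subst₂; module ≡-Reasoning)
open import Relation.Binary.Structures using (IsTotalOrder)
open import Relation.Nullary using (¬_; Dec; yes; no; does; contradiction; ¬?)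
open import Relation.Nullary.Decidable
  using (_×-dec_; _⊎-dec_; _→-dec_; dec-true; decidable-stable; ¬¬-excluded-middle)
open import Relation.Nullary.Negation using (¬¬-Monad)
open import Relation.Unary using (Pred; Decidable)

private
  variable
    ℓ : Level
    n : ℕ

∈-tabulate : (f : Fin n → Bool) {x : Fin n} → x ∈ tabulate f ⇔ f x ≡ true
∈-tabulate f {x} = mk⇔ (λ x∈f → trans (sym (lookup∘tabulate f x)) ([]=⇒lookup x∈f))
                       (λ fx≡true → lookup⇒[]= x (tabulate f) (trans (lookup∘tabulate f x) fx≡true))

subsetOf : {P : Pred (Fin n) ℓ} → Decidable P → Subset n
subsetOf P? = tabulate (does ∘ P?)

∈-subsetOf : {P : Pred (Fin n) ℓ} (P? : Decidable P) {x : Fin n} → x ∈ subsetOf P? ⇔ P x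
∈-subsetOf P? {x} = mk⇔ (λ x∈P → witness (P? x) (Equivalence.to (∈-tabulate (does ∘ P?)) x∈P))
                        (λ Px → Equivalence.from (∈-tabulate (does ∘ P?)) (dec-true (P? x) Px))
  where
    witness : ∀ {A : Set ℓ} (A? : Dec A) → does A? ≡ true → A
    witness (yes a) _ = a

⊆⇒⊇⊎⊂ : {p q : Subset n} → p ⊆ q → q ⊆ p ⊎ p ⊂ q
⊆⇒⊇⊎⊂ {p = p} {q} p⊆q with any? (λ x → (x ∈? q) ×-dec ¬? (x ∈? p))
... | yes q∖p∋x = inj₂ (p⊆q , q∖p∋x)
... | no  q∖p≡∅ = inj₁ λ {x} x∈q → decidable-stable (x ∈? p) (λ x∉p → q∖p≡∅ (x , x∈q , x∉p))

module _ {ℓ : Level} where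
  open RawMonad (¬¬-Monad {a = ℓ})

  ¬¬-∀-Fin : {P : Pred (Fin n) ℓ} → (∀ i → ¬ ¬ P i) → ¬ ¬ (∀ i → P i)
  ¬¬-∀-Fin {n = zero}  ¬¬P = pure λ ()
  ¬¬-∀-Fin {n = suc n} ¬¬P = do
    P0 ← ¬¬P zero
    P∘suc ← ¬¬-∀-Fin (¬¬P ∘ suc)
    pure λ { zero → P0 ; (suc i) → P∘suc i }

  ¬¬-decidable : (P : Pred (Fin n) ℓ) → ¬ ¬ Decidable P
  ¬¬-decidable P = ¬¬-∀-Fin (λ _ → ¬¬-excluded-middle)

module OrderedFieldProperties (𝔽 : OrderedField) where
  open OrderedField 𝔽 public

  commutativeRing : CommutativeRing 0ℓ 0ℓ
  commutativeRing = record { isCommutativeRing = isCommutativeRing }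

  open CommutativeRing commutativeRing public
    using (_-_; +-assoc; +-comm; +-identityˡ; +-identityʳ; -‿inverseʳ;
           *-assoc; *-comm; *-identityˡ; *-identityʳ; zeroˡ; zeroʳ; distribˡ; distribʳ)
  open RingProperties (CommutativeRing.ring commutativeRing) public
    using (+-cancelˡ; +-cancelʳ; -0#≈0#; -‿involutive; -‿distribˡ-*; -‿distribʳ-*; -1*x≈-x; -‿+-comm;
           x[y-z]≈xy-xz; [y-z]x≈yx-zx; +-inverseˡ-unique; //-rightDividesˡ; //-rightDividesʳ; x∙y⁻¹≈ε⇒x≈y)
  open IsTotalOrder isTotalOrder public
    using (total; antisym) renaming (refl to ≤-refl; trans to ≤-trans)
  open ≡-Reasoning

  <-≤-trans : ∀ {x y z} → x < y → y ≤ z → x < z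
  <-≤-trans (x≤y , x≢y) y≤z = ≤-trans x≤y y≤z , λ { refl → x≢y (antisym x≤y y≤z) }

  <-asym : ∀ {x y} → x < y → ¬ (y < x)
  <-asym (x≤y , x≢y) (y≤x , _) = x≢y (antisym x≤y y≤x)

  <⇒≱ : ∀ {x y} → x < y → ¬ (y ≤ x)
  <⇒≱ (x≤y , x≢y) y≤x = x≢y (antisym x≤y y≤x)

  ≰⇒> : ∀ {x y} → ¬ (x ≤ y) → y < x
  ≰⇒> {x} {y} x≰y with total x y
  ... | inj₁ x≤y = contradiction x≤y x≰y
  ... | inj₂ y≤x = y≤x , λ { refl → x≰y ≤-refl }

  x≤y⇒0≤y-x : ∀ {x y} → x ≤ y → 0# ≤ y - x
  x≤y⇒0≤y-x {x} {y} x≤y = subst (_≤ y - x) (-‿inverseʳ x) (+-mono-≤ (- x) x≤y)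

  0≤y-x⇒x≤y : ∀ {x y} → 0# ≤ y - x → x ≤ y
  0≤y-x⇒x≤y {x} {y} 0≤y-x = subst₂ _≤_ (+-identityˡ x) (//-rightDividesˡ x y) (+-mono-≤ x 0≤y-x)

  x<y⇒0<y-x : ∀ {x y} → x < y → 0# < y - x
  x<y⇒0<y-x {x} {y} (x≤y , x≢y) =
    x≤y⇒0≤y-x x≤y , λ 0≡y-x → x≢y (sym (x∙y⁻¹≈ε⇒x≈y y x (sym 0≡y-x)))

  0<y-x⇒x<y : ∀ {x y} → 0# < y - x → x < y
  0<y-x⇒x<y {x} {y} (0≤y-x , 0≢y-x) = 0≤y-x⇒x≤y 0≤y-x , λ { refl → 0≢y-x (sym (-‿inverseʳ x)) }

  +-monoʳ-≤ : ∀ {x y} z → x ≤ y → z + x ≤ z + y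
  +-monoʳ-≤ {x} {y} z x≤y = subst₂ _≤_ (+-comm x z) (+-comm y z) (+-mono-≤ z x≤y)

  +-cancelʳ-≤ : ∀ {x y} z → x + z ≤ y + z → x ≤ y
  +-cancelʳ-≤ {x} {y} z x+z≤y+z =
    subst₂ _≤_ (//-rightDividesʳ z x) (//-rightDividesʳ z y) (+-mono-≤ (- z) x+z≤y+z)

  +-mono-<-≤ : ∀ {x y u v} → x < y → u ≤ v → x + u < y + v
  +-mono-<-≤ {x} {y} {u} {v} (x≤y , x≢y) u≤v =
    ≤-trans (+-mono-≤ u x≤y) (+-monoʳ-≤ y u≤v) ,
    λ x+u≡y+v → x≢y (antisym x≤y
      (+-cancelʳ-≤ u (≤-trans (+-monoʳ-≤ y u≤v) (subst (_≤ x + u) x+u≡y+v ≤-refl))))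

  +-monoʳ-< : ∀ {x y} z → x < y → z + x < z + y
  +-monoʳ-< {x} {y} z x<y = subst₂ _<_ (+-comm x z) (+-comm y z) (+-mono-<-≤ x<y (≤-refl {z}))

  +-cancelʳ-< : ∀ {x y} z → x + z < y + z → x < y
  +-cancelʳ-< z (x+z≤y+z , x+z≢y+z) = +-cancelʳ-≤ z x+z≤y+z , λ { refl → x+z≢y+z refl }

  -x+[x+z]≡z : ∀ x z → - x + (x + z) ≡ z
  -x+[x+z]≡z x z = begin
    - x + (x + z)  ≡⟨ sym (+-assoc (- x) x z) ⟩
    - x + x + z    ≡⟨ cong (_+ z) (trans (+-comm (- x) x) (-‿inverseʳ x)) ⟩
    0# + z         ≡⟨ +-identityˡ z ⟩
    z              ∎

  -‿anti-< : ∀ {x y} → x < y → - y < - x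
  -‿anti-< {x} {y} x<y = +-cancelʳ-< (x + y) (subst₂ _<_
    (sym (trans (cong (- y +_) (+-comm x y)) (-x+[x+z]≡z y x))) (sym (-x+[x+z]≡z x y)) x<y)

  x-y+[y+w]≡w+x : ∀ x y w → x - y + (y + w) ≡ w + x
  x-y+[y+w]≡w+x x y w = begin
    x - y + (y + w)    ≡⟨ +-assoc x (- y) (y + w) ⟩
    x + (- y + (y + w)) ≡⟨ cong (x +_) (-x+[x+z]≡z y w) ⟩
    x + w              ≡⟨ +-comm x w ⟩
    w + x              ∎

  z-w+[y+w]≡z+y : ∀ z w y → z - w + (y + w) ≡ z + y
  z-w+[y+w]≡z+y z w y = begin
    z - w + (y + w)     ≡⟨ cong (z - w +_) (+-comm y w) ⟩
    z - w + (w + y)     ≡⟨ +-assoc z (- w) (w + y) ⟩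
    z + (- w + (w + y)) ≡⟨ cong (z +_) (-x+[x+z]≡z w y) ⟩
    z + y               ∎

  x-y≤z-w⇒w+x≤z+y : ∀ {x y z w} → x - y ≤ z - w → w + x ≤ z + y
  x-y≤z-w⇒w+x≤z+y {x} {y} {z} {w} le =
    subst₂ _≤_ (x-y+[y+w]≡w+x x y w) (z-w+[y+w]≡z+y z w y) (+-mono-≤ (y + w) le)

  x-y<z-w⇒w+x<z+y : ∀ {x y z w} → x - y < z - w → w + x < z + y
  x-y<z-w⇒w+x<z+y {x} {y} {z} {w} lt =
    subst₂ _<_ (x-y+[y+w]≡w+x x y w) (z-w+[y+w]≡z+y z w y) (+-mono-<-≤ lt (≤-refl {y + w}))

  x-y≡z-w⇒w+x≡z+y : ∀ {x y z w} → x - y ≡ z - w → w + x ≡ z + y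
  x-y≡z-w⇒w+x≡z+y {x} {y} {z} {w} eq =
    trans (sym (x-y+[y+w]≡w+x x y w)) (trans (cong (_+ (y + w)) eq) (z-w+[y+w]≡z+y z w y))

  *-monoˡ-≤-nonNeg : ∀ {t x y} → 0# ≤ t → x ≤ y → t * x ≤ t * y
  *-monoˡ-≤-nonNeg {t} {x} {y} 0≤t x≤y =
    0≤y-x⇒x≤y (subst (0# ≤_) (x[y-z]≈xy-xz t y x) (*-nonneg 0≤t (x≤y⇒0≤y-x x≤y)))

  *-monoʳ-≤-nonNeg : ∀ {t x y} → 0# ≤ t → x ≤ y → x * t ≤ y * t
  *-monoʳ-≤-nonNeg {t} {x} {y} 0≤t x≤y = subst₂ _≤_ (*-comm t x) (*-comm t y) (*-monoˡ-≤-nonNeg 0≤t x≤y)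

  *-cancelˡ-≡0 : ∀ {t x} → t ≢ 0# → t * x ≡ 0# → x ≡ 0#
  *-cancelˡ-≡0 {t} {x} t≢0 tx≡0 = begin
    x                 ≡⟨ sym (*-identityˡ x) ⟩
    1# * x            ≡⟨ cong (_* x) (sym (trans (*-comm (t ⁻¹) t) (⁻¹-inverse t t≢0))) ⟩
    t ⁻¹ * t * x      ≡⟨ *-assoc (t ⁻¹) t x ⟩
    t ⁻¹ * (t * x)    ≡⟨ cong (t ⁻¹ *_) tx≡0 ⟩
    t ⁻¹ * 0#         ≡⟨ zeroʳ (t ⁻¹) ⟩
    0#                ∎

  *-monoˡ-<-pos : ∀ {t x y} → 0# < t → x < y → t * x < t * y
  *-monoˡ-<-pos {t} {x} {y} (0≤t , 0≢t) (x≤y , x≢y) =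
    *-monoˡ-≤-nonNeg 0≤t x≤y ,
    λ tx≡ty → x≢y (sym (x∙y⁻¹≈ε⇒x≈y y x
      (*-cancelˡ-≡0 (λ t≡0 → 0≢t (sym t≡0)) (trans (x[y-z]≈xy-xz t y x) (ty-tx≡0 tx≡ty)))))
    where
      ty-tx≡0 : t * x ≡ t * y → t * y - t * x ≡ 0#
      ty-tx≡0 eq = trans (cong (λ z → t * y - z) eq) (-‿inverseʳ (t * y))

  *-monoʳ-<-pos : ∀ {t x y} → 0# < t → x < y → x * t < y * t
  *-monoʳ-<-pos {t} {x} {y} 0<t x<y = subst₂ _<_ (*-comm t x) (*-comm t y) (*-monoˡ-<-pos 0<t x<y)

  *-pos : ∀ {x y} → 0# < x → 0# < y → 0# < x * y
  *-pos {x} 0<x 0<y = subst (_< _) (zeroʳ x) (*-monoˡ-<-pos 0<x 0<y)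

  trade-off : ∀ {t x y x′ y′} → 0# < t → x + t * y ≡ x′ + t * y′ → y < y′ → x′ < x
  trade-off {t} {x} {y} {x′} {y′} 0<t eq y<y′ =
    +-cancelʳ-< (t * y) (subst (x′ + t * y <_) (sym eq) (+-monoʳ-< x′ (*-monoˡ-<-pos 0<t y<y′)))

  0≤x*x : ∀ x → 0# ≤ x * x
  0≤x*x x with total 0# x
  ... | inj₁ 0≤x = *-nonneg 0≤x 0≤x
  ... | inj₂ x≤0 = subst (0# ≤_) -x*-x≡x*x (*-nonneg 0≤-x 0≤-x)
    where
      0≤-x : 0# ≤ - x
      0≤-x = subst (0# ≤_) (+-identityˡ (- x)) (x≤y⇒0≤y-x x≤0)
      -x*-x≡x*x : - x * - x ≡ x * x
      -x*-x≡x*x = begin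
        - x * - x      ≡⟨ sym (-‿distribˡ-* x (- x)) ⟩
        - (x * - x)    ≡⟨ cong -_ (sym (-‿distribʳ-* x x)) ⟩
        - - (x * x)    ≡⟨ -‿involutive (x * x) ⟩
        x * x          ∎

  0<1 : 0# < 1#
  0<1 = subst (0# ≤_) (*-identityˡ 1#) (0≤x*x 1#) , 0≢1

  x<x+1 : ∀ x → x < x + 1#
  x<x+1 x = subst₂ _<_ (+-identityˡ x) (+-comm 1# x) (+-mono-<-≤ 0<1 (≤-refl {x}))

  0<x⇒x≢0 : ∀ {x} → 0# < x → x ≢ 0#
  0<x⇒x≢0 (_ , 0≢x) x≡0 = 0≢x (sym x≡0)

  0<x⇒0<x⁻¹ : ∀ {x} → 0# < x → 0# < x ⁻¹
  0<x⇒0<x⁻¹ {x} (0≤x , 0≢x) =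
    subst (0# ≤_) x[x⁻¹x⁻¹]≡x⁻¹ (*-nonneg 0≤x (0≤x*x (x ⁻¹))) ,
    λ 0≡x⁻¹ → 0≢1 (trans (sym (zeroʳ x)) (trans (cong (x *_) 0≡x⁻¹) (⁻¹-inverse x x≢0)))
    where
      x≢0 : x ≢ 0#
      x≢0 x≡0 = 0≢x (sym x≡0)
      x[x⁻¹x⁻¹]≡x⁻¹ : x * (x ⁻¹ * x ⁻¹) ≡ x ⁻¹
      x[x⁻¹x⁻¹]≡x⁻¹ = begin
        x * (x ⁻¹ * x ⁻¹)   ≡⟨ sym (*-assoc x (x ⁻¹) (x ⁻¹)) ⟩
        x * x ⁻¹ * x ⁻¹     ≡⟨ cong (_* x ⁻¹) (⁻¹-inverse x x≢0) ⟩
        1# * x ⁻¹           ≡⟨ *-identityˡ (x ⁻¹) ⟩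
        x ⁻¹                ∎

  x*y⁻¹*y≡x : ∀ x {y} → y ≢ 0# → x * y ⁻¹ * y ≡ x
  x*y⁻¹*y≡x x {y} y≢0 = begin
    x * y ⁻¹ * y     ≡⟨ *-assoc x (y ⁻¹) y ⟩
    x * (y ⁻¹ * y)   ≡⟨ cong (x *_) (trans (*-comm (y ⁻¹) y) (⁻¹-inverse y y≢0)) ⟩
    x * 1#           ≡⟨ *-identityʳ x ⟩
    x                ∎

module LinearAlgebra (𝔽 : OrderedField) where
  open OrderedFieldProperties 𝔽
  open Polytope 𝔽
  open CommutativeSemigroupProperties (CommutativeRing.+-commutativeSemigroup commutativeRing)
    using (interchange)
  open ≡-Reasoning

  sumOver : {A : Set} → (A → Carrier) → List A → Carrier
  sumOver f xs = foldr _+_ 0# (map f xs)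

  module _ {A : Set} where

    sumOver-cong : ∀ {f g : A → Carrier} → (∀ x → f x ≡ g x) → ∀ xs → sumOver f xs ≡ sumOver g xs
    sumOver-cong f≗g []       = refl
    sumOver-cong f≗g (x ∷ xs) = cong₂ _+_ (f≗g x) (sumOver-cong f≗g xs)

    sumOver-+ : ∀ (f g : A → Carrier) xs → sumOver (λ x → f x + g x) xs ≡ sumOver f xs + sumOver g xs
    sumOver-+ f g []       = sym (+-identityʳ 0#)
    sumOver-+ f g (x ∷ xs) =
      trans (cong (f x + g x +_) (sumOver-+ f g xs)) (interchange (f x) (g x) (sumOver f xs) (sumOver g xs))

    sumOver-minus : ∀ (f g : A → Carrier) xs → sumOver (λ x → f x - g x) xs ≡ sumOver f xs - sumOver g xs
    sumOver-minus f g xs = trans (sumOver-+ f (-_ ∘ g) xs) (cong (sumOver f xs +_) (sumOver-neg xs))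
      where
        sumOver-neg : ∀ xs → sumOver (-_ ∘ g) xs ≡ - sumOver g xs
        sumOver-neg []       = sym -0#≈0#
        sumOver-neg (x ∷ xs) = trans (cong (- g x +_) (sumOver-neg xs)) (-‿+-comm (g x) (sumOver g xs))

    sumOver-* : ∀ t (f : A → Carrier) xs → sumOver (λ x → t * f x) xs ≡ t * sumOver f xs
    sumOver-* t f []       = sym (zeroʳ t)
    sumOver-* t f (x ∷ xs) = trans (cong (t * f x +_) (sumOver-* t f xs)) (sym (distribˡ t (f x) (sumOver f xs)))

  ΣF-cong : ∀ {m} {f g : Fin m → Carrier} → (∀ k → f k ≡ g k) → ΣF f ≡ ΣF g
  ΣF-cong {m} f≗g = sumOver-cong f≗g (allFin m)

  ΣF-+ : ∀ {m} (f g : Fin m → Carrier) → ΣF (λ k → f k + g k) ≡ ΣF f + ΣF g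
  ΣF-+ {m} f g = sumOver-+ f g (allFin m)

  ΣF-minus : ∀ {m} (f g : Fin m → Carrier) → ΣF (λ k → f k - g k) ≡ ΣF f - ΣF g
  ΣF-minus {m} f g = sumOver-minus f g (allFin m)

  ΣF-* : ∀ {m} t (f : Fin m → Carrier) → ΣF (λ k → t * f k) ≡ t * ΣF f
  ΣF-* {m} t f = sumOver-* t f (allFin m)

  ΣF-suc : ∀ {m} (f : Fin (suc m) → Carrier) → ΣF f ≡ f zero + ΣF (f ∘ suc)
  ΣF-suc f = cong (λ xs → f zero + foldr _+_ 0# xs)
                  (trans (map-tabulate suc f) (sym (map-tabulate id (f ∘ suc))))

  _⊕_ : ∀ {d} → Point d → Point d → Point d
  (c ⊕ c′) k = c k + c′ k

  _⊛_ : ∀ {d} → Carrier → Point d → Point d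
  (t ⊛ c) k = t * c k

  ·-distribʳ-⊕ : ∀ {d} (c c′ x : Point d) → (c ⊕ c′) · x ≡ c · x + c′ · x
  ·-distribʳ-⊕ c c′ x =
    trans (ΣF-cong (λ k → distribʳ (x k) (c k) (c′ k))) (ΣF-+ (λ k → c k * x k) (λ k → c′ k * x k))

  ·-⊛ : ∀ {d} t (c x : Point d) → (t ⊛ c) · x ≡ t * (c · x)
  ·-⊛ t c x = trans (ΣF-cong (λ k → *-assoc t (c k) (x k))) (ΣF-* t (λ k → c k * x k))

  ·-congˡ : ∀ {d} (c : Point d) {x y : Point d} → (∀ k → x k ≡ y k) → c · x ≡ c · y
  ·-congˡ c x≗y = ΣF-cong (λ k → cong (c k *_) (x≗y k))

  δ : ∀ {m} → Fin m → Fin m → Carrier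
  δ zero    zero    = 1#
  δ zero    (suc _) = 0#
  δ (suc _) zero    = 0#
  δ (suc i) (suc k) = δ i k

  δ-diag : ∀ {m} (i : Fin m) → δ i i ≡ 1#
  δ-diag zero    = refl
  δ-diag (suc i) = δ-diag i

  δ-off : ∀ {m} {i j : Fin m} → i ≢ j → δ i j ≡ 0#
  δ-off {i = zero}  {zero}  i≢j = contradiction refl i≢j
  δ-off {i = zero}  {suc j} i≢j = refl
  δ-off {i = suc i} {zero}  i≢j = refl
  δ-off {i = suc i} {suc j} i≢j = δ-off (i≢j ∘ cong suc)

  ΣF-δ* : ∀ {m} (i : Fin m) (x : Fin m → Carrier) → ΣF (λ k → δ i k * x k) ≡ x i
  ΣF-δ* zero x = begin
    ΣF (λ k → δ zero k * x k)                ≡⟨ ΣF-suc (λ k → δ zero k * x k) ⟩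
    1# * x zero + ΣF (λ k → 0# * x (suc k))  ≡⟨ cong₂ _+_ (*-identityˡ (x zero)) (ΣF-* 0# (x ∘ suc)) ⟩
    x zero + 0# * ΣF (x ∘ suc)               ≡⟨ cong (x zero +_) (zeroˡ (ΣF (x ∘ suc))) ⟩
    x zero + 0#                              ≡⟨ +-identityʳ (x zero) ⟩
    x zero                                   ∎
  ΣF-δ* (suc i) x = begin
    ΣF (λ k → δ (suc i) k * x k)                 ≡⟨ ΣF-suc (λ k → δ (suc i) k * x k) ⟩
    0# * x zero + ΣF (λ k → δ i k * x (suc k))   ≡⟨ cong₂ _+_ (zeroˡ (x zero)) (ΣF-δ* i (x ∘ suc)) ⟩
    0# + x (suc i)                               ≡⟨ +-identityˡ (x (suc i)) ⟩
    x (suc i)                                    ∎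

module FiniteExtrema (𝔽 : OrderedField) where
  open OrderedFieldProperties 𝔽

  argmin : ∀ {n} {C : Pred (Fin n) 0ℓ} → Decidable C → (r : Fin n → Carrier) → ∃ C →
           ∃ λ y → C y × (∀ x → C x → r y ≤ r x)
  argmin {suc n} {C} C? r (z , Cz) with any? (C? ∘ suc)
  ... | no ¬C∘suc = zero , C-zero z Cz , λ { zero _ → ≤-refl ; (suc x) Cx → contradiction (x , Cx) ¬C∘suc }
    where
      C-zero : ∀ z → C z → C zero
      C-zero zero    Cz = Cz
      C-zero (suc z) Cz = contradiction (z , Cz) ¬C∘suc
  ... | yes ∃C∘suc with argmin (C? ∘ suc) (r ∘ suc) ∃C∘suc | C? zero
  ...   | m , Cm , m-min | no ¬C0 = suc m , Cm , λ { zero C0 → contradiction C0 ¬C0 ; (suc x) Cx → m-min x Cx }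
  ...   | m , Cm , m-min | yes C0 with total (r zero) (r (suc m))
  ...     | inj₁ r0≤rm = zero , C0 , λ { zero _ → ≤-refl ; (suc x) Cx → ≤-trans r0≤rm (m-min x Cx) }
  ...     | inj₂ rm≤r0 = suc m , Cm , λ { zero _ → rm≤r0 ; (suc x) Cx → m-min x Cx }

  strict-upper-bound : ∀ {n} (f : Fin n → Carrier) → ∃ λ M → ∀ y → f y < M
  strict-upper-bound {zero}  f = 0# , λ ()
  strict-upper-bound {suc n} f with strict-upper-bound (f ∘ suc)
  ... | M , f∘suc<M with total (f zero + 1#) M
  ...   | inj₁ f0+1≤M = M , λ { zero → <-≤-trans (x<x+1 (f zero)) f0+1≤M ; (suc y) → f∘suc<M y }
  ...   | inj₂ M≤f0+1 = f zero + 1# , λ { zero → x<x+1 (f zero) ; (suc y) → <-≤-trans (f∘suc<M y) M≤f0+1 }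

  module _ {n} {I : Pred (Fin n) 0ℓ} (I? : Decidable I) (a b : Fin n → Carrier)
           (b≤0? : ∀ y → Dec (b y ≤ 0#)) where

    private
      ratio : Fin n → Carrier
      ratio y = a y * b y ⁻¹

    -- The largest t with t * b ≤ a on I is the least ratio a y / b y over the y ∈ I with b y > 0.
    largest-step : (∀ y → I y → 0# ≤ a y) → (∀ y → I y → 0# < b y → 0# < a y) →
                   (∃ λ z → I z × 0# < b z) →
                   ∃ λ t → 0# < t × (∀ y → I y → t * b y ≤ a y) × (∃ λ y → I y × 0# < b y × t * b y ≡ a y)
    largest-step 0≤a 0<a (z , Iz , 0<bz)
      with argmin (λ y → I? y ×-dec ¬? (b≤0? y)) ratio (z , Iz , <⇒≱ 0<bz)
    ... | y* , (Iy* , by*≰0) , y*-min =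
      ratio y* , 0<t , below , y* , Iy* , 0<by* , attained
      where
        0<by* : 0# < b y*
        0<by* = ≰⇒> by*≰0
        0<t : 0# < ratio y*
        0<t = *-pos (0<a y* Iy* 0<by*) (0<x⇒0<x⁻¹ 0<by*)
        ratio*b : ∀ y → 0# < b y → ratio y * b y ≡ a y
        ratio*b y 0<by = x*y⁻¹*y≡x (a y) (0<x⇒x≢0 0<by)
        below : ∀ y → I y → ratio y* * b y ≤ a y
        below y Iy with b≤0? y
        ... | yes by≤0 = ≤-trans (subst (_ ≤_) (zeroʳ (ratio y*)) (*-monoˡ-≤-nonNeg (proj₁ 0<t) by≤0)) (0≤a y Iy)
        ... | no by≰0 = subst (ratio y* * b y ≤_) (ratio*b y (≰⇒> by≰0))
                            (*-monoʳ-≤-nonNeg (proj₁ (≰⇒> by≰0)) (y*-min y (Iy , by≰0)))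
        attained : ratio y* * b y* ≡ a y*
        attained = ratio*b y* 0<by*

module AffineIndependence (𝔽 : OrderedField) where
  open OrderedFieldProperties 𝔽
  open Polytope 𝔽
  open LinearAlgebra 𝔽
  open ≡-Reasoning

  module _ {d : ℕ} where

    affinelyIndependent-tail : ∀ {m} {q : Fin (suc m) → Point d} →
                               AffinelyIndependent q → AffinelyIndependent (q ∘ suc)
    affinelyIndependent-tail {m} {q} indep λ′ Σλ′≡0 Σλ′q≡0 j = indep λ″ Σ≡0 Σq≡0 (suc j)
      where
        λ″ : Fin (suc m) → Carrier
        λ″ zero    = 0#
        λ″ (suc j) = λ′ j
        Σ≡0 : ΣF λ″ ≡ 0#
        Σ≡0 = trans (ΣF-suc λ″) (trans (+-identityˡ (ΣF λ′)) Σλ′≡0)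
        Σq≡0 : ∀ k → ΣF (λ j → λ″ j * q j k) ≡ 0#
        Σq≡0 k = begin
          ΣF (λ j → λ″ j * q j k)               ≡⟨ ΣF-suc (λ j → λ″ j * q j k) ⟩
          0# * q zero k + ΣF (λ j → λ′ j * qₛ j) ≡⟨ cong (_+ ΣF (λ j → λ′ j * qₛ j)) (zeroˡ (q zero k)) ⟩
          0# + ΣF (λ j → λ′ j * qₛ j)            ≡⟨ +-identityˡ (ΣF (λ j → λ′ j * qₛ j)) ⟩
          ΣF (λ j → λ′ j * qₛ j)                 ≡⟨ Σλ′q≡0 k ⟩
          0#                                    ∎
          where
            qₛ : Fin m → Carrier
            qₛ j = q (suc j) k

    -- The coefficients δ i - δ j form an affine dependence as soon as q i ≡ q j.
    affinelyIndependent-injective : ∀ {m} {q : Fin m → Point d} → AffinelyIndependent q →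
                                    ∀ i j → q i ≡ q j → i ≡ j
    affinelyIndependent-injective {m} {q} indep i j qi≡qj with i ≟ j
    ... | yes i≡j = i≡j
    ... | no  i≢j = contradiction λ′i≡0 λ′i≢0
      where
        λ′ : Fin m → Carrier
        λ′ k = δ i k - δ j k
        ΣF-δ : ∀ l → ΣF (δ l) ≡ 1#
        ΣF-δ l = trans (ΣF-cong (λ k → sym (*-identityʳ (δ l k)))) (ΣF-δ* l (const 1#))
        Σλ′≡0 : ΣF λ′ ≡ 0#
        Σλ′≡0 = trans (ΣF-minus (δ i) (δ j)) (trans (cong₂ _-_ (ΣF-δ i) (ΣF-δ j)) (-‿inverseʳ 1#))
        Σλ′q≡0 : ∀ k → ΣF (λ l → λ′ l * q l k) ≡ 0#
        Σλ′q≡0 k = begin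
          ΣF (λ l → λ′ l * qₖ l)                      ≡⟨ ΣF-cong (λ l → [y-z]x≈yx-zx (qₖ l) (δ i l) (δ j l)) ⟩
          ΣF (λ l → δ i l * qₖ l - δ j l * qₖ l)      ≡⟨ ΣF-minus (λ l → δ i l * qₖ l) (λ l → δ j l * qₖ l) ⟩
          ΣF (λ l → δ i l * qₖ l) - ΣF (λ l → δ j l * qₖ l) ≡⟨ cong₂ _-_ (ΣF-δ* i qₖ) (ΣF-δ* j qₖ) ⟩
          q i k - q j k                               ≡⟨ cong (λ x → x k - q j k) qi≡qj ⟩
          q j k - q j k                               ≡⟨ -‿inverseʳ (q j k) ⟩
          0#                                          ∎
          where
            qₖ : Fin m → Carrier
            qₖ l = q l k
        λ′i≡0 : λ′ i ≡ 0#
        λ′i≡0 = indep λ′ Σλ′≡0 Σλ′q≡0 i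
        λ′i≢0 : λ′ i ≢ 0#
        λ′i≢0 λ′i≡0 = 0≢1 (sym (begin
          1#              ≡⟨ sym (+-identityʳ 1#) ⟩
          1# + 0#         ≡⟨ cong (1# +_) (sym -0#≈0#) ⟩
          1# - 0#         ≡⟨ cong₂ _-_ (sym (δ-diag i)) (sym (δ-off (i≢j ∘ sym))) ⟩
          λ′ i            ≡⟨ λ′i≡0 ⟩
          0#              ∎))

    affinelyIndependent-pair : ∀ (x y : Point d) k → x k ≢ y k → AffinelyIndependent (lookup (x ∷ y ∷ []))
    affinelyIndependent-pair x y k xk≢yk λ′ Σλ′≡0 Σλ′q≡0 = λ′≡0
      where
        a b : Carrier
        a = λ′ zero
        b = λ′ (suc zero)
        a≡-b : a ≡ - b
        a≡-b = +-inverseˡ-unique a b (trans (cong (a +_) (sym (+-identityʳ b))) Σλ′≡0)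
        [yk-xk]b≡0 : (y k - x k) * b ≡ 0#
        [yk-xk]b≡0 = begin
          (y k - x k) * b        ≡⟨ *-comm (y k - x k) b ⟩
          b * (y k - x k)        ≡⟨ x[y-z]≈xy-xz b (y k) (x k) ⟩
          b * y k - b * x k      ≡⟨ +-comm (b * y k) (- (b * x k)) ⟩
          - (b * x k) + b * y k  ≡⟨ cong (_+ b * y k) (trans (-‿distribˡ-* b (x k)) (cong (_* x k) (sym a≡-b))) ⟩
          a * x k + b * y k      ≡⟨ cong (a * x k +_) (sym (+-identityʳ (b * y k))) ⟩
          a * x k + (b * y k + 0#) ≡⟨ Σλ′q≡0 k ⟩
          0#                     ∎
        b≡0 : b ≡ 0#
        b≡0 = *-cancelˡ-≡0 (λ yk-xk≡0 → xk≢yk (sym (x∙y⁻¹≈ε⇒x≈y (y k) (x k) yk-xk≡0))) [yk-xk]b≡0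
        λ′≡0 : ∀ j → λ′ j ≡ 0#
        λ′≡0 zero       = trans a≡-b (trans (cong -_ b≡0) -0#≈0#)
        λ′≡0 (suc zero) = b≡0

  module _ {d n : ℕ} (p : Fin n → Point d) where

    IndependentIn : Subset n → ℕ → Set
    IndependentIn S m = ∃ λ (q : Fin m → Fin n) → (∀ j → q j ∈ S) × AffinelyIndependent (λ j → p (q j))

    independentIn-shrink : ∀ {S m m′} → m ≤′ m′ → IndependentIn S m′ → IndependentIn S m
    independentIn-shrink (≤′-reflexive refl) indep = indep
    independentIn-shrink (≤′-step m≤′m′) (q , q∈S , indep) =
      independentIn-shrink m≤′m′ (q ∘ suc , q∈S ∘ suc , affinelyIndependent-tail indep)

    ¬HasDim-larger : ∀ {S i j} → i <ℕ j → HasDim p S i → ¬ HasDim p S j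
    ¬HasDim-larger i<j (_ , no-larger) (larger , _) =
      let (q , q∈S , indep) = independentIn-shrink (ℕ.≤⇒≤′ (s≤s i<j)) larger in no-larger q q∈S indep

    HasDim-unique : ∀ {S i j} → HasDim p S i → HasDim p S j → i ≡ j
    HasDim-unique {i = i} {j} dimᵢ dimⱼ with ℕ.<-cmp i j
    ... | tri< i<j _ _ = contradiction dimⱼ (¬HasDim-larger i<j dimᵢ)
    ... | tri≈ _ i≡j _ = i≡j
    ... | tri> _ _ j<i = contradiction dimᵢ (¬HasDim-larger j<i dimⱼ)

    -- A family of three vertices taken from {u, v} repeats a vertex.
    ¬independent-3-of-2 : ∀ {u v} (q : Fin 3 → Fin n) → (∀ j → q j ≡ u ⊎ q j ≡ v) →
                          ¬ AffinelyIndependent (λ j → p (q j))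
    ¬independent-3-of-2 {u} {v} q q∈uv indep =
      let (i , j , i<j , sideᵢ≡sideⱼ) = pigeonhole (ℕ.n<1+n 2) side
      in <-irrefl (affinelyIndependent-injective {q = λ j → p (q j)} indep i j
                    (cong p (qi≡qj i j sideᵢ≡sideⱼ))) i<j
      where
        side : Fin 3 → Fin 2
        side j with q∈uv j
        ... | inj₁ _ = zero
        ... | inj₂ _ = suc zero
        q≡ : ∀ j → q j ≡ lookup (u ∷ v ∷ []) (side j)
        q≡ j with q∈uv j
        ... | inj₁ qj≡u = qj≡u
        ... | inj₂ qj≡v = qj≡v
        qi≡qj : ∀ i j → side i ≡ side j → q i ≡ q j
        qi≡qj i j eq = trans (q≡ i) (trans (cong (lookup (u ∷ v ∷ [])) eq) (sym (q≡ j)))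

    HasDim-segment : ∀ {S u v} k → p u k ≢ p v k → u ∈ S → v ∈ S → (∀ w → w ∈ S → w ≡ u ⊎ w ≡ v) →
                     HasDim p S 1
    HasDim-segment {u = u} {v} k puk≢pvk u∈S v∈S S⊆uv =
      (lookup (u ∷ v ∷ []) , (λ { zero → u∈S ; (suc zero) → v∈S }) ,
       affinelyIndependent-pair (p u) (p v) k puk≢pvk) ,
      λ q q∈S → ¬independent-3-of-2 q (λ j → S⊆uv (q j) (q∈S j))

module FaceConstructions (𝔽 : OrderedField) {d n : ℕ} (p : Fin n → Polytope.Point 𝔽 d) where
  open OrderedFieldProperties 𝔽
  open Polytope 𝔽
  open LinearAlgebra 𝔽
  open FiniteExtrema 𝔽
  open Equivalence using (to; from)

  -- K is exposed by M c + φ for M large enough, which keeps every vertex off H strictly below the hyperplane.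
  IsFace-argmax : ∀ {H K : Subset n} → IsFace p H → (φ : Point d) (β : Carrier) →
                  (∀ y → y ∈ H → φ · p y ≤ β) → (∀ y → y ∈ K ⇔ (y ∈ H × φ · p y ≡ β)) → IsFace p K
  IsFace-argmax {H} {K} (c , b , c≤b , H⇔c≡b) φ β φ≤β K⇔ = c′ , b′ , c′≤b′ , K⇔c′≡b′
    where
      M : Carrier
      M = proj₁ (strict-upper-bound (λ y → (φ · p y - β) * (b - c · p y) ⁻¹))
      c′ : Point d
      c′ = (M ⊛ c) ⊕ φ
      b′ : Carrier
      b′ = M * b + β
      c′-expand : ∀ y → c′ · p y ≡ M * (c · p y) + φ · p y
      c′-expand y = trans (·-distribʳ-⊕ (M ⊛ c) φ (p y)) (cong (_+ φ · p y) (·-⊛ M c (p y)))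
      on-H : ∀ {y} → y ∈ H → c′ · p y ≡ M * b + φ · p y
      on-H {y} y∈H = trans (c′-expand y) (cong (λ x → M * x + φ · p y) (to (H⇔c≡b y) y∈H))
      off-H : ∀ {y} → y ∉ H → c′ · p y < b′
      off-H {y} y∉H = subst (_< b′) (sym (c′-expand y)) (x-y<z-w⇒w+x<z+y φy-β<M[b-cy])
        where
          0<b-cy : 0# < b - c · p y
          0<b-cy = x<y⇒0<y-x (c≤b y , λ cy≡b → y∉H (from (H⇔c≡b y) cy≡b))
          φy-β<M[b-cy] : φ · p y - β < M * b - M * (c · p y)
          φy-β<M[b-cy] = subst₂ _<_ (x*y⁻¹*y≡x (φ · p y - β) (0<x⇒x≢0 0<b-cy)) (x[y-z]≈xy-xz M b (c · p y))
                           (*-monoʳ-<-pos 0<b-cy (proj₂ (strict-upper-bound _) y))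
      c′≤b′ : ∀ y → c′ · p y ≤ b′
      c′≤b′ y with y ∈? H
      ... | yes y∈H = subst (_≤ b′) (sym (on-H y∈H)) (+-monoʳ-≤ (M * b) (φ≤β y y∈H))
      ... | no  y∉H = proj₁ (off-H y∉H)
      K⇔c′≡b′ : ∀ y → y ∈ K ⇔ (c′ · p y ≡ b′)
      K⇔c′≡b′ y = mk⇔ (λ y∈K → let (y∈H , φy≡β) = to (K⇔ y) y∈K in trans (on-H y∈H) (cong (M * b +_) φy≡β))
                      (λ c′y≡b′ → from (K⇔ y) (y∈H c′y≡b′ , φy≡β c′y≡b′))
        where
          y∈H : c′ · p y ≡ b′ → y ∈ H
          y∈H c′y≡b′ with y ∈? H
          ... | yes y∈H = y∈H
          ... | no  y∉H = contradiction c′y≡b′ (proj₂ (off-H y∉H))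
          φy≡β : c′ · p y ≡ b′ → φ · p y ≡ β
          φy≡β c′y≡b′ = +-cancelˡ (M * b) (φ · p y) β (trans (sym (on-H (y∈H c′y≡b′))) c′y≡b′)

  record Tilt (H : Subset n) (v : Fin n) (ψ χ : Point d) : Set where
    field
      t       : Carrier
      0<t     : 0# < t
      K       : Subset n
      K-face  : IsFace p K
      K⊆H     : K ⊆ H
      v∈K     : v ∈ K
      K-level : ∀ {y} → y ∈ K → ψ · p y + t * (χ · p y) ≡ ψ · p v + t * (χ · p v)
      y*      : Fin n
      y*∈K    : y* ∈ K
      χv<χy*  : χ · p v < χ · p y*

  -- Tilt ψ towards χ until another vertex of H catches up with v; the maximisers of ψ + t χ over H
  -- then include a vertex y* above v in direction χ.
  module _ {H : Subset n} {v : Fin n} (H-face : IsFace p H) (v∈H : v ∈ H) (ψ χ : Point d)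
           (ψ-max : ∀ y → y ∈ H → y ≢ v → ψ · p y < ψ · p v) {z : Fin n} (z∈H : z ∈ H)
           (χv<χz : χ · p v < χ · p z) where

    private
      a b : Fin n → Carrier
      a y = ψ · p v - ψ · p y
      b y = χ · p y - χ · p v

      0≤a : ∀ y → y ∈ H → 0# ≤ a y
      0≤a y y∈H with y ≟ v
      ... | yes refl = subst (0# ≤_) (sym (-‿inverseʳ (ψ · p v))) ≤-refl
      ... | no  y≢v  = proj₁ (x<y⇒0<y-x (ψ-max y y∈H y≢v))

      0<a : ∀ y → y ∈ H → 0# < b y → 0# < a y
      0<a y y∈H 0<by with y ≟ v
      ... | yes refl = contradiction (sym (-‿inverseʳ (χ · p v))) (proj₂ 0<by)
      ... | no  y≢v  = x<y⇒0<y-x (ψ-max y y∈H y≢v)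

      φ-of : Carrier → Point d
      φ-of t = ψ ⊕ (t ⊛ χ)

    tilted : ∀ t → 0# < t → (∀ y → y ∈ H → t * b y ≤ a y) →
             ∀ {y*} → y* ∈ H → 0# < b y* → t * b y* ≡ a y* →
             (∀ y → Dec (φ-of t · p y ≡ φ-of t · p v)) → Tilt H v ψ χ
    tilted t 0<t tb≤a {y*} y*∈H 0<by* tby*≡ay* level? = record
      { t = t ; 0<t = 0<t ; K = K ; K-face = IsFace-argmax H-face φ (φ · p v) φ≤φv (λ y → ∈-subsetOf K?)
      ; K⊆H = λ y∈K → proj₁ (to (∈-subsetOf K?) y∈K)
      ; v∈K = from (∈-subsetOf K?) (v∈H , refl)
      ; K-level = λ y∈K → trans (sym (φ-expand _)) (trans (proj₂ (to (∈-subsetOf K?) y∈K)) (φ-expand v))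
      ; y* = y* ; y*∈K = from (∈-subsetOf K?) (y*∈H , φy*≡φv) ; χv<χy* = 0<y-x⇒x<y 0<by* }
      where
        φ : Point d
        φ = φ-of t
        K? : ∀ y → Dec (y ∈ H × φ · p y ≡ φ · p v)
        K? y = (y ∈? H) ×-dec level? y
        K : Subset n
        K = subsetOf K?
        φ-expand : ∀ y → φ · p y ≡ ψ · p y + t * (χ · p y)
        φ-expand y = trans (·-distribʳ-⊕ ψ (t ⊛ χ) (p y)) (cong (ψ · p y +_) (·-⊛ t χ (p y)))
        tb≡ : ∀ y → t * b y ≡ t * (χ · p y) - t * (χ · p v)
        tb≡ y = x[y-z]≈xy-xz t (χ · p y) (χ · p v)
        φ≤φv : ∀ y → y ∈ H → φ · p y ≤ φ · p v
        φ≤φv y y∈H = subst₂ _≤_ (sym (φ-expand y)) (sym (φ-expand v))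
                       (x-y≤z-w⇒w+x≤z+y (subst (_≤ a y) (tb≡ y) (tb≤a y y∈H)))
        φy*≡φv : φ · p y* ≡ φ · p v
        φy*≡φv = trans (φ-expand y*) (trans (x-y≡z-w⇒w+x≡z+y (trans (sym (tb≡ y*)) tby*≡ay*)) (sym (φ-expand v)))

    tilt : ¬ ¬ Tilt H v ψ χ
    tilt = do
      b≤0? ← ¬¬-decidable (λ y → b y ≤ 0#)
      let (t , 0<t , tb≤a , y* , y*∈H , 0<by* , tby*≡ay*) =
            largest-step (_∈? H) a b b≤0? 0≤a 0<a (z , z∈H , x<y⇒0<y-x χv<χz)
      level? ← ¬¬-decidable (λ y → φ-of t · p y ≡ φ-of t · p v)
      pure (tilted t 0<t tb≤a y*∈H 0<by* tby*≡ay* level?)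
      where open RawMonad (¬¬-Monad {a = 0ℓ})

module StarLemma (𝔽 : OrderedField) {d n : ℕ} {p : Fin n → Polytope.Point 𝔽 d}
                 (poly : Polytope.IsDPolytope 𝔽 d n p)
                 {G : Subset n} (G-face : Polytope.IsFace 𝔽 p G) {v : Fin n} (v∈G : v ∈ G) where
  open OrderedFieldProperties 𝔽
  open Polytope 𝔽
  open LinearAlgebra 𝔽
  open AffineIndependence 𝔽
  open FaceConstructions 𝔽 p
  open RawMonad (¬¬-Monad {a = 0ℓ}) using (pure; _>>=_)
  open Equivalence using (to; from)

  Star : Subset n → Set
  Star H = ∀ y → y ∈ H → IsEdge p y v → y ∈ G

  private
    ψ : Point d
    ψ = proj₁ (IsDPolytope.vertex poly v)

    ψ-max : ∀ y → y ≢ v → ψ · p y < ψ · p v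
    ψ-max = proj₂ (IsDPolytope.vertex poly v)

    cG : Point d
    cG = proj₁ G-face

    cG-level : ∀ {y} → y ∈ G → cG · p y ≡ cG · p v
    cG-level {y} y∈G = let (_ , _ , G⇔) = proj₂ G-face in trans (to (G⇔ y) y∈G) (sym (to (G⇔ v) v∈G))

    χG : Point d
    χG = (- 1#) ⊛ cG

    χG-expand : ∀ y → χG · p y ≡ - (cG · p y)
    χG-expand y = trans (·-⊛ (- 1#) cG (p y)) (-1*x≈-x (cG · p y))

    χG-level : ∀ {y} → y ∈ G → χG · p y ≡ χG · p v
    χG-level {y} y∈G = trans (χG-expand y) (trans (cong -_ (cG-level y∈G)) (sym (χG-expand v)))

    χG-off : ∀ {w} → w ∉ G → χG · p v < χG · p w
    χG-off {w} w∉G = subst₂ _<_ (sym (χG-expand v)) (sym (χG-expand w)) (-‿anti-< cGw<cGv)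
      where
        cGw<cGv : cG · p w < cG · p v
        cGw<cGv = let (bG , cG≤bG , G⇔) = proj₂ G-face in
          subst (cG · p w ≤_) (sym (to (G⇔ v) v∈G)) (cG≤bG w) ,
          λ cGw≡cGv → w∉G (from (G⇔ w) (trans cGw≡cGv (to (G⇔ v) v∈G)))

  module _ {H : Subset n} (H-face : IsFace p H) (v∈H : v ∈ H) (star : Star H)
           (smaller : ∀ {K} → ∣ K ∣ <ℕ ∣ H ∣ → IsFace p K → v ∈ K → Star K → K ⊆ G) where

    Flat : Point d → Set
    Flat χ = ∃ λ t → 0# < t × ∀ {y} → y ∈ H → ψ · p y + t * (χ · p y) ≡ ψ · p v + t * (χ · p v)

    -- A tilt of ψ towards χ stays flat on H, for otherwise the tilted face is a smaller counterexample.
    flatten : ∀ χ {z} → z ∈ H → χ · p v < χ · p z → (∀ {y} → y ∈ H → y ∈ G → χ · p y ≤ χ · p v) →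
              ¬ ¬ Flat χ
    flatten χ z∈H χv<χz G-low = tilt H-face v∈H ψ χ (λ y _ → ψ-max y) z∈H χv<χz >>= flat-or-smaller
      where
        flat-or-smaller : Tilt H v ψ χ → ¬ ¬ Flat χ
        flat-or-smaller T =
          [ (λ H⊆K → pure (t , 0<t , λ {y} y∈H → K-level (H⊆K y∈H)))
          , (λ K⊂H → contradiction (y*∈G K⊂H) y*∉G)
          ]′ (⊆⇒⊇⊎⊂ K⊆H)
          where
            open Tilt T
            y*∈G : K ⊂ H → y* ∈ G
            y*∈G K⊂H = smaller (p⊂q⇒∣p∣<∣q∣ K⊂H) K-face v∈K (λ y y∈K → star y (K⊆H y∈K)) y*∈K
            y*∉G : y* ∉ G
            y*∉G y*∈G = <⇒≱ χv<χy* (G-low (K⊆H y*∈K) y*∈G)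

    Flat-χG⇒H∩G⊆v : Flat χG → ∀ {y} → y ∈ H → y ∈ G → y ≡ v
    Flat-χG⇒H∩G⊆v (t , _ , flat) {y} y∈H y∈G with y ≟ v
    ... | yes y≡v = y≡v
    ... | no  y≢v = contradiction ψy≡ψv (proj₂ (ψ-max y y≢v))
      where
        ψy≡ψv : ψ · p y ≡ ψ · p v
        ψy≡ψv = +-cancelʳ (t * (χG · p v)) (ψ · p y) (ψ · p v)
                  (trans (cong (λ x → ψ · p y + t * x) (sym (χG-level y∈G))) (flat y∈H))

    ¬escape-edge : ∀ {w} → w ∈ H → w ∉ G → (∀ y → y ∈ H → y ≡ w ⊎ y ≡ v) → ⊥
    ¬escape-edge {w} w∈H w∉G H⊆wv = ¬¬-decidable (λ k → p w k ≡ p v k) edge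
      where
        w≢v : w ≢ v
        w≢v w≡v = w∉G (subst (_∈ G) (sym w≡v) v∈G)
        edge : (∀ k → Dec (p w k ≡ p v k)) → ⊥
        edge coord? with all? coord?
        ... | yes pw≡pv = proj₂ (ψ-max w w≢v) (·-congˡ ψ pw≡pv)
        ... | no  pw≢pv = let (k , pwk≢pvk) = ¬∀⟶∃¬ d _ coord? pw≢pv in
          w∉G (star w w∈H (w≢v , H , H-face , HasDim-segment p k pwk≢pvk w∈H v∈H H⊆wv , w∈H , v∈H , H⊆wv))

    -- Tilting towards the exposing functionals of two further vertices w and x of H orders ψ w and ψ x both ways.
    ¬escape-triangle : (∀ {y} → y ∈ H → y ∈ G → y ≡ v) →
                       ∀ {w x} → w ∈ H → x ∈ H → w ≢ v → x ≢ v → x ≢ w → ¬ ¬ ⊥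
    ¬escape-triangle H∩G⊆v {w} {x} w∈H x∈H w≢v x≢v x≢w = do
      (tw , 0<tw , flat-w) ← flatten χw w∈H (χw-max v (w≢v ∘ sym)) (G-low χw)
      (tx , 0<tx , flat-x) ← flatten χx x∈H (χx-max v (x≢v ∘ sym)) (G-low χx)
      pure (<-asym (trade-off 0<tw (trans (flat-w x∈H) (sym (flat-w w∈H))) (χw-max x x≢w))
                   (trade-off 0<tx (trans (flat-x w∈H) (sym (flat-x x∈H))) (χx-max w (x≢w ∘ sym))))
      where
        χw χx : Point d
        χw = proj₁ (IsDPolytope.vertex poly w)
        χx = proj₁ (IsDPolytope.vertex poly x)
        χw-max : ∀ y → y ≢ w → χw · p y < χw · p w
        χw-max = proj₂ (IsDPolytope.vertex poly w)
        χx-max : ∀ y → y ≢ x → χx · p y < χx · p x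
        χx-max = proj₂ (IsDPolytope.vertex poly x)
        G-low : ∀ χ {y} → y ∈ H → y ∈ G → χ · p y ≤ χ · p v
        G-low χ y∈H y∈G = subst (λ u → χ · p u ≤ χ · p v) (sym (H∩G⊆v y∈H y∈G)) ≤-refl

    ¬escape : ∀ {w} → w ∈ H → w ∉ G → ¬ ¬ ⊥
    ¬escape {w} w∈H w∉G = do
      flat-χG ← flatten χG w∈H (χG-off w∉G) (λ _ y∈G → subst (_≤ χG · p v) (sym (χG-level y∈G)) ≤-refl)
      by-shape (Flat-χG⇒H∩G⊆v flat-χG) (all? (λ y → (y ∈? H) →-dec ((y ≟ w) ⊎-dec (y ≟ v))))
      where
        by-shape : (∀ {y} → y ∈ H → y ∈ G → y ≡ v) → Dec (∀ y → y ∈ H → y ≡ w ⊎ y ≡ v) → ¬ ¬ ⊥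
        by-shape _ (yes H⊆wv) = pure (¬escape-edge w∈H w∉G H⊆wv)
        by-shape H∩G⊆v (no H⊈wv) =
          let (x , ¬x∈H⇒x∈wv) = ¬∀⟶∃¬ n _ (λ y → (y ∈? H) →-dec ((y ≟ w) ⊎-dec (y ≟ v))) H⊈wv
              x∈H = decidable-stable (x ∈? H) (λ x∉H → ¬x∈H⇒x∈wv (λ x∈H → contradiction x∈H x∉H))
          in ¬escape-triangle H∩G⊆v w∈H x∈H (λ w≡v → w∉G (subst (_∈ G) (sym w≡v) v∈G))
               (λ x≡v → ¬x∈H⇒x∈wv (λ _ → inj₂ x≡v)) (λ x≡w → ¬x∈H⇒x∈wv (λ _ → inj₁ x≡w))

  star⊆⇒⊆ : ∀ {H} → IsFace p H → v ∈ H → Star H → H ⊆ G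
  star⊆⇒⊆ {H} = bounded (suc ∣ H ∣) (ℕ.n<1+n ∣ H ∣)
    where
      bounded : ∀ m {H} → ∣ H ∣ <ℕ m → IsFace p H → v ∈ H → Star H → H ⊆ G
      bounded (suc m) (s≤s ∣H∣≤m) H-face v∈H star {w} w∈H with w ∈? G
      ... | yes w∈G = w∈G
      ... | no  w∉G = ⊥-elim (¬escape H-face v∈H star
                                (λ ∣K∣<∣H∣ → bounded m (ℕ.<-≤-trans ∣K∣<∣H∣ ∣H∣≤m)) w∈H w∉G id)

open import Data.Nat using (_+_; _^_; _≤_; _≥_; z≤n)

length-concatMap : ∀ {A B : Set} (f : A → List B) xs → length (concatMap f xs) ≡ sum (map (length ∘ f) xs)
length-concatMap f []       = refl
length-concatMap f (x ∷ xs) = trans (length-++ (f x)) (cong (length (f x) +_) (length-concatMap f xs))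

length-≤-injection : ∀ {A B : Set} {R : A → B → Set} {xs : List A} {ys : List B} → Unique xs →
                     (∀ {x} → x ∈ₗ xs → ∃ λ y → y ∈ₗ ys × R x y) →
                     (∀ {x x′} y → x ∈ₗ xs → x′ ∈ₗ xs → R x y → R x′ y → x ≡ x′) →
                     length xs ≤ length ys
length-≤-injection {xs = []} _ _ _ = z≤n
length-≤-injection {R = R} {xs = x ∷ xs} (x∉xs ∷ unique) image injective with image (here refl)
... | y , y∈ys , Rxy with ∈-∃++ y∈ys
...   | as , bs , refl = subst (suc (length xs) ≤_) (sym length-as++y∷bs)
                           (s≤s (length-≤-injection unique image′ λ y′ x∈ x′∈ → injective y′ (there x∈) (there x′∈)))
  where
    length-as++y∷bs : length (as ++ y ∷ bs) ≡ suc (length (as ++ bs))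
    length-as++y∷bs =
      trans (length-++ as) (trans (ℕ.+-suc (length as) (length bs)) (cong suc (sym (length-++ as))))
    image′ : ∀ {x′} → x′ ∈ₗ xs → ∃ λ y′ → y′ ∈ₗ as ++ bs × R x′ y′
    image′ x′∈xs with image (there x′∈xs)
    ... | y′ , y′∈ys , Rx′y′ with ∈-++⁻ as y′∈ys
    ...   | inj₁ y′∈as          = y′ , ∈-++⁺ˡ y′∈as , Rx′y′
    ...   | inj₂ (there y′∈bs)  = y′ , ∈-++⁺ʳ as y′∈bs , Rx′y′
    ...   | inj₂ (here refl)    =
      contradiction (injective y (here refl) (there x′∈xs) Rxy Rx′y′) (All.lookup x∉xs x′∈xs)

subsets : Subset n → List (Subset n)
subsets []            = [] ∷ []
subsets (inside ∷ p)  = map (inside ∷_) (subsets p) ++ map (outside ∷_) (subsets p)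
subsets (outside ∷ p) = map (outside ∷_) (subsets p)

length-subsets : (p : Subset n) → length (subsets p) ≡ 2 ^ ∣ p ∣
length-subsets []            = refl
length-subsets (inside ∷ p)  = begin
  length (map (inside ∷_) (subsets p) ++ map (outside ∷_) (subsets p))
    ≡⟨ length-++ (map (inside ∷_) (subsets p)) ⟩
  length (map (inside ∷_) (subsets p)) + length (map (outside ∷_) (subsets p))
    ≡⟨ cong₂ _+_ (length-map _ (subsets p)) (length-map _ (subsets p)) ⟩
  length (subsets p) + length (subsets p)
    ≡⟨ cong₂ _+_ (length-subsets p) (trans (length-subsets p) (sym (ℕ.+-identityʳ _))) ⟩
  2 ^ ∣ p ∣ + (2 ^ ∣ p ∣ + 0)
    ∎
  where open ≡-Reasoning
length-subsets (outside ∷ p) = trans (length-map _ (subsets p)) (length-subsets p)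

∈-subsets : {p q : Subset n} → q ⊆ p → q ∈ₗ subsets p
∈-subsets {p = []}          {[]}          _   = here refl
∈-subsets {p = inside ∷ p}  {inside ∷ q}  q⊆p = ∈-++⁺ˡ (∈-map⁺ (inside ∷_) (∈-subsets (drop-∷-⊆ q⊆p)))
∈-subsets {p = inside ∷ p}  {outside ∷ q} q⊆p =
  ∈-++⁺ʳ (map (inside ∷_) (subsets p)) (∈-map⁺ (outside ∷_) (∈-subsets (drop-∷-⊆ q⊆p)))
∈-subsets {p = outside ∷ p} {inside ∷ q}  q⊆p = contradiction (q⊆p here) λ ()
∈-subsets {p = outside ∷ p} {outside ∷ q} q⊆p = ∈-map⁺ (outside ∷_) (∈-subsets (drop-∷-⊆ q⊆p))

∣tabulate∣ : (f : Fin n → Bool) → ∣ tabulate f ∣ ≡ sum (map (λ u → if f u then 1 else 0) (allFin n))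
∣tabulate∣ {zero}  f = refl
∣tabulate∣ {suc n} f = trans (∣∷∣ (f zero) (tabulate (f ∘ suc)))
                             (cong ((if f zero then 1 else 0) +_) (trans (∣tabulate∣ (f ∘ suc)) (cong sum allFin-suc)))
  where
    ∣∷∣ : ∀ b (p : Subset n) → ∣ b ∷ p ∣ ≡ (if b then 1 else 0) + ∣ p ∣
    ∣∷∣ true  p = refl
    ∣∷∣ false p = refl
    indicator : Fin (suc n) → ℕ
    indicator u = if f u then 1 else 0
    allFin-suc : map (indicator ∘ suc) (allFin n) ≡ map indicator (List.tabulate suc)
    allFin-suc = trans (map-tabulate id (indicator ∘ suc)) (sym (map-tabulate suc indicator))

module _ {n : ℕ} (o : Fin n → Fin n → Bool)
         (acyclic : ∀ v → ¬ TransClosure (λ x y → o x y ≡ true) v v) where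

  -- Without a sink every vertex of S has a successor in S, and a walk of n + 1 steps must repeat a vertex.
  sink-exists : ∀ {S : Subset n} {s} → s ∈ S → ∃ λ x → x ∈ S × ∀ u → u ∈ S → o x u ≡ false
  sink-exists {S} {s} s∈S with any? (λ x → (x ∈? S) ×-dec all? (λ u → (u ∈? S) →-dec (o x u Bool.≟ false)))
  ... | yes sink = sink
  ... | no  no-sink = ⊥-elim (let (x , x⁺x) = cycle in acyclic x x⁺x)
    where
      Arc : Fin n → Fin n → Set
      Arc x y = o x y ≡ true
      successor : ∀ {x} → x ∈ S → ∃ λ u → u ∈ S × Arc x u
      successor {x} x∈S =
        let (u , ¬[u∈S⇒oxu≡false]) = ¬∀⟶∃¬ n _ (λ u → (u ∈? S) →-dec (o x u Bool.≟ false))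
                                        (λ x-sink → no-sink (x , x∈S , x-sink))
        in u , decidable-stable (u ∈? S) (λ u∉S → ¬[u∈S⇒oxu≡false] (λ u∈S → ⊥-elim (u∉S u∈S))) ,
           ¬-not (λ oxu≡false → ¬[u∈S⇒oxu≡false] (λ _ → oxu≡false))
      walk : ℕ → ∃ (_∈ S)
      walk zero    = s , s∈S
      walk (suc k) = let (u , u∈S , _) = successor (proj₂ (walk k)) in u , u∈S
      w : ℕ → Fin n
      w k = proj₁ (walk k)
      step : ∀ k → Arc (w k) (w (suc k))
      step k = proj₂ (proj₂ (successor (proj₂ (walk k))))
      path : ∀ i k → TransClosure Arc (w i) (w (suc (k + i)))
      path i zero    = [ step i ]
      path i (suc k) = path i k ∷ʳ step (suc (k + i))
      cycle : ∃ λ x → TransClosure Arc x x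
      cycle with pigeonhole (ℕ.n<1+n n) (w ∘ toℕ)
      ... | i , j , i<j , wi≡wj with ℕ.m≤n⇒∃[o]m+o≡n i<j
      ...   | k , 1+i+k≡j = w (toℕ i) , subst (TransClosure Arc (w (toℕ i))) returns (path (toℕ i) k)
        where
          returns : w (suc (k + toℕ i)) ≡ w (toℕ i)
          returns = trans (cong (w ∘ suc) (ℕ.+-comm k (toℕ i))) (trans (cong w 1+i+k≡j) (sym wi≡wj))

module Theorem (𝔽 : OrderedField) {d n : ℕ} {p : Fin n → Polytope.Point 𝔽 d}
               (poly : Polytope.IsDPolytope 𝔽 d n p)
               {o : Fin n → Fin n → Bool} (orientation : Polytope.IsOrientation 𝔽 p o) where
  open Polytope 𝔽
  open AffineIndependence 𝔽 using (HasDim-unique)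
  open Equivalence using (to; from)

  SinkOfFace : Fin n × Subset n → Set
  SinkOfFace vS = IsFace p (proj₂ vS) × IsSinkOf p o (proj₁ vS) (proj₂ vS)

  FaceOfDim : ℕ × Subset n → Set
  FaceOfDim iS = (proj₁ iS ≤ d) × IsFace p (proj₂ iS) × HasDim p (proj₂ iS) (proj₁ iS)

  inArcs : Fin n → Subset n
  inArcs v = tabulate (λ u → o u v)

  trace : Fin n × Subset n → Fin n × Subset n
  trace vS = proj₁ vS , proj₂ vS ∩ inArcs (proj₁ vS)

  sink-face-⊆ : ∀ {v S S′} → SinkOfFace (v , S) → SinkOfFace (v , S′) → S ∩ inArcs v ⊆ S′ → S ⊆ S′
  sink-face-⊆ {v} (S-face , v∈S , into-v) (S′-face , v∈S′ , _) S∩in⊆S′ =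
    StarLemma.star⊆⇒⊆ 𝔽 poly S′-face v∈S′ S-face v∈S
      (λ y y∈S y~v → S∩in⊆S′ (x∈p∩q⁺ (y∈S , from (∈-tabulate (λ u → o u v)) (into-v y y∈S y~v))))

  sink-face-unique : ∀ {v S S′} → SinkOfFace (v , S) → SinkOfFace (v , S′) →
                     S ∩ inArcs v ≡ S′ ∩ inArcs v → S ≡ S′
  sink-face-unique {v} {S} {S′} sinkS sinkS′ eq =
    ⊆-antisym (sink-face-⊆ sinkS sinkS′ (λ y∈ → p∩q⊆p S′ (inArcs v) (subst (_ ∈_) eq y∈)))
              (sink-face-⊆ sinkS′ sinkS (λ y∈ → p∩q⊆p S (inArcs v) (subst (_ ∈_) (sym eq) y∈)))

  sinks≤fO : ∀ {L₁} → Enumerates SinkOfFace L₁ → length L₁ ≤ fO p o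
  sinks≤fO {L₁} (unique , L₁⇔) = subst (length L₁ ≤_) length-pairs (length-≤-injection unique image injective)
    where
      pairs : List (Fin n × Subset n)
      pairs = concatMap (λ v → map (v ,_) (subsets (inArcs v))) (allFin n)
      image : ∀ {vS} → vS ∈ₗ L₁ → ∃ λ vT → vT ∈ₗ pairs × vT ≡ trace vS
      image {v , S} _ = _ , ∈-concatMap⁺ _ (Any.map (λ { refl → ∈-map⁺ (v ,_) (∈-subsets (p∩q⊆q S (inArcs v))) })
                                                    (∈-allFin v)) , refl
      injective : ∀ {vS vS′} vT → vS ∈ₗ L₁ → vS′ ∈ₗ L₁ → vT ≡ trace vS → vT ≡ trace vS′ → vS ≡ vS′
      injective {v , S} {v′ , S′} _ m m′ refl e with cong proj₁ e
      ... | refl = cong (v ,_) (sink-face-unique (to (L₁⇔ _) m) (to (L₁⇔ _) m′) (cong proj₂ e))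
      length-pairs : length pairs ≡ fO p o
      length-pairs = trans (length-concatMap _ (allFin n)) (cong sum (map-cong (λ v →
        trans (length-map (v ,_) (subsets (inArcs v)))
              (trans (length-subsets (inArcs v)) (cong (2 ^_) (∣tabulate∣ (λ u → o u v))))) (allFin n)))

  faces≤sinks : Acyclic p o → ∀ {L₁ L₂} → Enumerates SinkOfFace L₁ → Enumerates FaceOfDim L₂ →
                length L₂ ≤ length L₁
  faces≤sinks acyclic {L₁} {L₂} (_ , L₁⇔) (unique , L₂⇔) = length-≤-injection unique image injective
    where
      SameFace : ℕ × Subset n → Fin n × Subset n → Set
      SameFace iS vS = proj₂ vS ≡ proj₂ iS
      image : ∀ {iS} → iS ∈ₗ L₂ → ∃ λ vS → vS ∈ₗ L₁ × SameFace iS vS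
      image {i , S} m with to (L₂⇔ _) m
      ... | _ , S-face , ((q , q∈S , _) , _) with sink-exists o acyclic (q∈S zero)
      ...   | x , x∈S , x-sink = (x , S) , from (L₁⇔ _) (S-face , x∈S , into-x) , refl
        where
          into-x : ∀ u → u ∈ S → IsEdge p u x → o u x ≡ true
          into-x u u∈S u~x with IsOrientation.edge⇒one orientation u x u~x
          ... | inj₁ (oux≡true , _) = oux≡true
          ... | inj₂ (_ , oxu≡true) = contradiction (trans (sym (x-sink u u∈S)) oxu≡true) λ ()
      injective : ∀ {iS iS′} vS → iS ∈ₗ L₂ → iS′ ∈ₗ L₂ → SameFace iS vS → SameFace iS′ vS → iS ≡ iS′
      injective {i , S} {i′ , .S} _ m m′ refl refl =
        cong (_, S) (HasDim-unique p (proj₂ (proj₂ (to (L₂⇔ _) m))) (proj₂ (proj₂ (to (L₂⇔ _) m′))))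

lemma1 : (𝔽 : OrderedField) → let open Polytope 𝔽 in
    (d n : ℕ) (p : Fin n → Point d) → IsDPolytope d n p →
    (o : Fin n → Fin n → Bool) → IsOrientation p o → Acyclic p o →
    (L₁ : List (Fin n × Subset n)) →
    Enumerates (λ vS → IsFace p (proj₂ vS) × IsSinkOf p o (proj₁ vS) (proj₂ vS)) L₁ →
    (L₂ : List (ℕ × Subset n)) →
    Enumerates (λ iS → (proj₁ iS ≤ d) × IsFace p (proj₂ iS) × HasDim p (proj₂ iS) (proj₁ iS)) L₂ →
    (fO p o ≥ length L₁) × (length L₁ ≥ length L₂)
lemma1 𝔽 d n p poly o orientation acyclic L₁ sinks L₂ faces = sinks≤fO sinks , faces≤sinks acyclic sinks faces
  where open Theorem 𝔽 poly orientation
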